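{- Let $f=f_1\cdots f_n\in F_n$. Define permutations $\tau_i$ of $[i]$, $i=1,\dots,n$, as follows, starting from the empty permutation $\tau_0$ of $\emptyset$: for $i=1,2,\dots,n$, if $f_i=i$ then $\tau_i$ is obtained from $\tau_{i-1}$ by adding the new singleton cycle $(i)$; if $f_i<i$ then $\tau_i$ is obtained from $\tau_{i-1}$ by inserting $i$ immediately before $f_i$ in the cycle of $\tau_{i-1}$ containing $f_i$ (that is, if $a=\tau_{i-1}^{ -1}(f_i)$, then $\tau_i(a)=i$, $\tau_i(i)=f_i$, and $\tau_i(x)=\tau_{i-1}(x)$ for all other $x\in[i-1]$). Then $\tau_n=\phi(f)$.
   Context: $[n]=\{1,\dots,n\}$, $\mathfrak{S}_n$ the symmetric group on $[n]$; products of permutations are composed with the leftmost factor acting first: $(\alpha\beta)(x)=\beta(\alpha(x))$. Cycle notation $(a_1,a_2,\dots,a_m)$ means $a_1\mapsto a_2\mapsto\cdots\mapsto a_m\mapsto a_1$. A function $f:[n]\to[n]$ is subexceedant if $1\le f(i)\le i$ for all $i$, written as the word $f_1\cdots f_n$; $F_n$ is the set of such functions. $\phi:F_n\to\mathfrak{S}_n$ is defined by $\phi(f)=(1,f_1)(2,f_2)\cdots(n,f_n)$ (with $(i,i)$ the identity). -}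

module Defs where

open import Data.Nat using (ℕ; zero; suc)
open import Data.Fin using (Fin; zero; suc; inject₁; fromℕ; _≟_)
open import Data.Maybe using (Maybe; just; nothing)
import Data.Maybe as Maybe
open import Relation.Nullary using (yes; no)

-- Convention: [n] = {1,…,n} is represented by Fin n, the element k of [n]
-- corresponding to the Fin element with toℕ = k - 1.  The largest element
-- n ∈ [n] is  fromℕ (n - 1) ; the embedding [n-1] ⊆ [n] is inject₁.

-- Subexceedant functions f = f₁ ⋯ fₙ, built as snoc-lists:
-- (f ▷ c) : F (suc n) extends f : F n by the value f_{n+1} = c ∈ [n+1].
infixl 5 _▷_
data F : ℕ → Set where
  ε   : F 0
  _▷_ : ∀ {n} → F n → Fin (suc n) → F (suc n)

-- View of an element of [n+1]: either the largest element n+1 (nothing)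
-- or an element of [n] (just y, meaning inject₁ y).
unlast : ∀ {n} → Fin (suc n) → Maybe (Fin n)
unlast {zero}  zero    = nothing
unlast {suc n} zero    = just zero
unlast {suc n} (suc i) = Maybe.map suc (unlast i)

-- Permutations are represented by their underlying functions Fin n → Fin n;
-- equality of permutations is pointwise equality.

transposition : ∀ {n} → Fin n → Fin n → Fin n → Fin n
transposition i j x with x ≟ i
... | yes _ = j
... | no _ with x ≟ j
...   | yes _ = i
...   | no _  = x

extend : ∀ {n} → (Fin n → Fin n) → Fin (suc n) → Fin (suc n)
extend {n} σ x with unlast x
... | nothing = x
... | just y  = inject₁ (σ y)

-- φ(f) = (1,f₁)(2,f₂)⋯(n,fₙ), leftmost factor acting first, so
-- φ(f ▷ c)(x) = (n+1, c) applied to φ(f)(x).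
φ : ∀ {n} → F n → Fin n → Fin n
φ ε ()
φ {suc n} (f ▷ c) x = transposition (fromℕ n) c (extend (φ f) x)

preimage : ∀ {m k} → (Fin m → Fin k) → Fin k → Maybe (Fin m)
preimage {zero}  σ y = nothing
preimage {suc m} σ y with σ zero ≟ y
... | yes _ = just zero
... | no _  = Maybe.map suc (preimage {m} (λ i → σ (suc i)) y)

-- The insertion construction τ₀, τ₁, …, τₙ; τ f is τ_n for f ∈ F n.
--  * f_{n+1} = n+1 : add the singleton cycle (n+1);
--  * f_{n+1} = c < n+1 : with a = τ_n⁻¹(c), set τ(a) = n+1, τ(n+1) = c,
--    τ(x) = τ_n(x) otherwise.
τ : ∀ {n} → F n → Fin n → Fin n
τ ε ()
τ {suc n} (f ▷ c) x with unlast c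
... | nothing = extend (τ f) x
... | just c′ with unlast x
...   | nothing = c
...   | just y with preimage (τ f) c′
...     | nothing = inject₁ (τ f y)
...     | just a with y ≟ a
...       | yes _ = fromℕ n
...       | no _  = inject₁ (τ f y)

{-# OPTIONS --safe #-}
-- Appending c to f post-composes the extension of φ f by the
-- fixed point n+1 with the transposition (n+1, c).  For c = n+1 this just adds
-- the fixed point; otherwise it sends n+1 to c, the unique a with φ f a = c
-- (which is τ f a = c by induction) to n+1, and fixes everything else: this is
-- exactly the insertion of n+1 before c.
module Submission where

open import Defs
open import Data.Nat using (ℕ; zero; suc)
open import Data.Fin using (Fin; zero; suc; inject₁; fromℕ; _≟_)
open import Data.Fin.Properties using (fromℕ≢inject₁; inject₁-injective)
open import Data.Fin.Relation.Unary.Top using (view; ‵fromℕ; ‵inject₁)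
import Data.Fin.Permutation.Components as Components
open import Data.Maybe using (just; nothing)
open import Function using (_∘_)
open import Relation.Nullary using (yes; no; contradiction)
open import Relation.Binary.PropositionalEquality

private
  variable
    m n k : ℕ

unlast-fromℕ : ∀ n → unlast (fromℕ n) ≡ nothing
unlast-fromℕ zero = refl
unlast-fromℕ (suc n) rewrite unlast-fromℕ n = refl

unlast-inject₁ : (y : Fin n) → unlast (inject₁ y) ≡ just y
unlast-inject₁ {suc _} zero = refl
unlast-inject₁ {suc _} (suc y) rewrite unlast-inject₁ y = refl

preimage-just : (σ : Fin m → Fin k) {y : Fin k} {a : Fin m} →
                preimage σ y ≡ just a → σ a ≡ y
preimage-just {suc m} σ {y} p with σ zero ≟ y
preimage-just {suc m} σ refl | yes σ0≡y = σ0≡y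
... | no _ with preimage {m} (σ ∘ suc) y in q
preimage-just {suc m} σ refl | no _ | just _ = preimage-just (σ ∘ suc) q

preimage-nothing : (σ : Fin m → Fin k) {y : Fin k} →
                   preimage σ y ≡ nothing → ∀ a → σ a ≢ y
preimage-nothing {suc m} σ {y} p a with σ zero ≟ y
preimage-nothing {suc m} σ () a | yes _
... | no σ0≢y with preimage {m} (σ ∘ suc) y in q
preimage-nothing {suc m} σ p zero    | no σ0≢y | nothing = σ0≢y
preimage-nothing {suc m} σ p (suc a) | no σ0≢y | nothing = preimage-nothing (σ ∘ suc) q a

transposition≗transpose : (i j x : Fin n) → transposition i j x ≡ Components.transpose i j x
transposition≗transpose i j x with x ≟ i
... | yes _ = refl
... | no _ with x ≟ j
...   | yes _ = refl
...   | no _  = refl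

transposition-injective : (i j : Fin n) {x y : Fin n} →
                          transposition i j x ≡ transposition i j y → x ≡ y
transposition-injective i j {x} {y} e = begin
  x                                                     ≡⟨ Components.transpose-inverse j i ⟨
  Components.transpose j i (Components.transpose i j x) ≡⟨ cong (Components.transpose j i) t ⟩
  Components.transpose j i (Components.transpose i j y) ≡⟨ Components.transpose-inverse j i ⟩
  y                                                     ∎
  where
  open ≡-Reasoning
  t : Components.transpose i j x ≡ Components.transpose i j y
  t = trans (sym (transposition≗transpose i j x)) (trans e (transposition≗transpose i j y))

transposition-self : (i x : Fin n) → transposition i i x ≡ x
transposition-self i x with x ≟ i
... | yes x≡i = sym x≡i
... | no x≢i with x ≟ i
...   | yes x≡i = contradiction x≡i x≢i
...   | no _    = refl

transposition-first : (i j : Fin n) → transposition i j i ≡ j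
transposition-first i j with i ≟ i
... | yes _  = refl
... | no i≢i = contradiction refl i≢i

transposition-second : (i j : Fin n) → j ≢ i → transposition i j j ≡ i
transposition-second i j j≢i with j ≟ i
... | yes j≡i = contradiction j≡i j≢i
... | no _ with j ≟ j
...   | yes _  = refl
...   | no j≢j = contradiction refl j≢j

transposition-other : (i j x : Fin n) → x ≢ i → x ≢ j → transposition i j x ≡ x
transposition-other i j x x≢i x≢j with x ≟ i
... | yes x≡i = contradiction x≡i x≢i
... | no _ with x ≟ j
...   | yes x≡j = contradiction x≡j x≢j
...   | no _    = refl

extend-fromℕ : (σ : Fin n → Fin n) → extend σ (fromℕ n) ≡ fromℕ n
extend-fromℕ {n} σ rewrite unlast-fromℕ n = refl

extend-inject₁ : (σ : Fin n → Fin n) (y : Fin n) → extend σ (inject₁ y) ≡ inject₁ (σ y)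
extend-inject₁ σ y rewrite unlast-inject₁ y = refl

extend-cong : {σ σ′ : Fin n → Fin n} → (∀ y → σ y ≡ σ′ y) → ∀ x → extend σ x ≡ extend σ′ x
extend-cong σ≗σ′ x with unlast x
... | nothing = refl
... | just y  = cong inject₁ (σ≗σ′ y)

extend-injective : (σ : Fin n → Fin n) → (∀ {a b} → σ a ≡ σ b → a ≡ b) →
                   ∀ {x x′} → extend σ x ≡ extend σ x′ → x ≡ x′
extend-injective σ σ-injective {x} {x′} e with view x | view x′
... | ‵fromℕ     | ‵fromℕ      = refl
... | ‵fromℕ     | ‵inject₁ y′ =
  contradiction (trans (sym (extend-fromℕ σ)) (trans e (extend-inject₁ σ y′))) fromℕ≢inject₁
... | ‵inject₁ y | ‵fromℕ      =
  contradiction (trans (sym (extend-fromℕ σ)) (trans (sym e) (extend-inject₁ σ y))) fromℕ≢inject₁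
... | ‵inject₁ y | ‵inject₁ y′ = cong inject₁ (σ-injective (inject₁-injective
  (trans (sym (extend-inject₁ σ y)) (trans e (extend-inject₁ σ y′)))))

φ-injective : (f : F n) {a b : Fin n} → φ f a ≡ φ f b → a ≡ b
φ-injective {suc n} (f ▷ c) =
  extend-injective (φ f) (φ-injective f) ∘ transposition-injective (fromℕ n) c

transposition-fromℕ-hit : (c : Fin n) → transposition (fromℕ n) (inject₁ c) (inject₁ c) ≡ fromℕ n
transposition-fromℕ-hit c = transposition-second (fromℕ _) (inject₁ c) (fromℕ≢inject₁ ∘ sym)

transposition-fromℕ-miss : {c z : Fin n} → z ≢ c →
                           transposition (fromℕ n) (inject₁ c) (inject₁ z) ≡ inject₁ z
transposition-fromℕ-miss z≢c =
  transposition-other _ _ _ (fromℕ≢inject₁ ∘ sym) (z≢c ∘ inject₁-injective)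

φ-▷-fromℕ : (f : F n) (x : Fin (suc n)) → φ (f ▷ fromℕ n) x ≡ extend (φ f) x
φ-▷-fromℕ {n} f x = transposition-self (fromℕ n) (extend (φ f) x)

τ≗φ-▷ : (f : F n) (c : Fin (suc n)) → (∀ y → τ f y ≡ φ f y) → ∀ x → τ (f ▷ c) x ≡ φ (f ▷ c) x
τ≗φ-▷ {n} f c τ≗φ x with view c
... | ‵fromℕ rewrite unlast-fromℕ n = trans (extend-cong τ≗φ x) (sym (φ-▷-fromℕ f x))
... | ‵inject₁ c′ rewrite unlast-inject₁ c′ with view x
...   | ‵fromℕ rewrite unlast-fromℕ n = sym (transposition-first (fromℕ n) (inject₁ c′))
...   | ‵inject₁ y rewrite unlast-inject₁ y with preimage (τ f) c′ in p
...     | nothing = trans (cong inject₁ (τ≗φ y))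
                          (sym (transposition-fromℕ-miss (preimage-nothing (τ f) p y ∘ trans (τ≗φ y))))
...     | just a with y ≟ a
...       | yes refl = sym (trans (cong (transposition (fromℕ n) (inject₁ c′) ∘ inject₁) φy≡c′)
                                  (transposition-fromℕ-hit c′))
  where
  φy≡c′ : φ f y ≡ c′
  φy≡c′ = trans (sym (τ≗φ y)) (preimage-just (τ f) p)
...       | no y≢a = trans (cong inject₁ (τ≗φ y))
                           (sym (transposition-fromℕ-miss (y≢a ∘ φ-injective f ∘ φy≡φa)))
  where
  φy≡φa : φ f y ≡ c′ → φ f y ≡ φ f a
  φy≡φa φy≡c′ = trans φy≡c′ (trans (sym (preimage-just (τ f) p)) (τ≗φ a))

proposition3p2 : (n : ℕ) (f : F n) (x : Fin n) → τ f x ≡ φ f x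
proposition3p2 zero    ε       ()
proposition3p2 (suc n) (f ▷ c) = τ≗φ-▷ f c (proposition3p2 n f)
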